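{- Let $\Gamma$ be a distance-regular graph of diameter $d$ with intersection numbers $p_{i,j}^k$, and let $p$ be a prime. Let $G$ be an automorphism group of $\Gamma$ acting on the vertex set with $n$ orbits, all of the same length, and for $i=1,\dots,d$ let $M_i$ be the $n\times n$ quotient matrix of the distance-$i$ matrix $A_i$ of $\Gamma$ with respect to the orbit partition of $G$. If there exists $i\in\{1,2,\dots,d\}$ such that $p$ divides $p_{i,i}^k$ for all $k\in\{0,1,\dots,d\}$, then the rows of $M_i$ (with entries reduced modulo $p$) span a self-orthogonal linear code of length $n$ over $\mathbb{F}_q$, where $q=p^m$ for any positive integer $m$.
   Context: For a connected graph $\Gamma$ of diameter $d$, the distance-$i$ matrix $A_i$ has $(u,v)$-entry $1$ if the distance between $u,v$ is $i$ and $0$ otherwise. $\Gamma$ is distance-regular if for all $0\le i,j,k\le d$ there is a constant $p_{i,j}^k$ such that any vertices $v,w$ at distance $k$ satisfy $|\{z: \delta(v,z)=i,\ \delta(z,w)=j\}|=p_{i,j}^k$. For a partition of the vertex set into cells $C_0,\dots,C_{n-1}$ that is equitable for the graph with adjacency matrix $A_i$ (every vertex of $C_a$ has the same number $b_{a,b}$ of $A_i$-neighbours in $C_b$), the quotient matrix is $(b_{a,b})$. A linear code $C\subseteq\mathbb{F}_q^n$ is self-orthogonal if $C\subseteq C^\perp$ under the standard inner product. -}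

module Defs where

open import Level using (Level; _⊔_) renaming (suc to lsuc)
open import Data.Bool using (Bool; true; false; _∧_; _∨_; not; if_then_else_)
open import Data.Nat using (ℕ; zero; suc; _≤_; _<_) renaming (_+_ to _+ℕ_)
open import Data.Fin using (Fin; _≟_)
open import Data.Product using (Σ; _×_; _,_; ∃)
open import Data.List using (List)
open import Data.List.Membership.Propositional using (_∈_)
open import Relation.Binary.PropositionalEquality using (_≡_)
open import Relation.Nullary using (¬_)
open import Relation.Nullary.Decidable using (⌊_⌋)
open import Algebra.Bundles using (CommutativeRing)

count : ∀ {N} → (Fin N → Bool) → ℕ
count {zero}  P = 0
count {suc N} P = (if P Fin.zero then 1 else 0) +ℕ count {N} (λ x → P (Fin.suc x))

anyF : ∀ {N} → (Fin N → Bool) → Bool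
anyF {zero}  P = false
anyF {suc N} P = P Fin.zero ∨ anyF {N} (λ x → P (Fin.suc x))

record Graph (N : ℕ) : Set where
  field
    adj     : Fin N → Fin N → Bool
    symm    : ∀ u v → adj u v ≡ adj v u
    irrefl  : ∀ u → adj u u ≡ false

module _ {N : ℕ} (Γ : Graph N) where
  open Graph Γ

  reach : ℕ → Fin N → Fin N → Bool
  reach zero    u v = ⌊ u ≟ v ⌋
  reach (suc k) u v = reach k u v ∨ anyF (λ w → adj u w ∧ reach k w v)

  -- As reach is monotone in k, for a connected graph this is the least k
  -- with a walk of length ≤ k, i.e. the usual path distance δ(u,v).
  dist : Fin N → Fin N → ℕ
  dist u v = count {N} (λ k → not (reach (Data.Fin.toℕ k) u v))

  Connected : Set
  Connected = ∀ u v → reach N u v ≡ true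

  ⌊≡⌋ : ℕ → ℕ → Bool
  ⌊≡⌋ a b = ⌊ a Data.Nat.≟ b ⌋

  HasDiameter : ℕ → Set
  HasDiameter d = Connected × (∀ u v → dist u v ≤ d) × ∃ (λ u → ∃ (λ v → dist u v ≡ d))

  IsDistanceRegular : ℕ → (ℕ → ℕ → ℕ → ℕ) → Set
  IsDistanceRegular d p =
    HasDiameter d ×
    (∀ i j k → i ≤ d → j ≤ d → k ≤ d → ∀ v w → dist v w ≡ k →
       count (λ z → ⌊≡⌋ (dist v z) i ∧ ⌊≡⌋ (dist z w) j) ≡ p i j k)

  record Automorphism : Set where
    field
      fun     : Fin N → Fin N
      inv     : Fin N → Fin N
      inv-l   : ∀ u → inv (fun u) ≡ u
      inv-r   : ∀ u → fun (inv u) ≡ u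
      pres    : ∀ u v → adj (fun u) (fun v) ≡ adj u v

  open Automorphism

  IsAutGroup : List Automorphism → Set
  IsAutGroup G =
    (∃ λ e → e ∈ G × (∀ u → fun e u ≡ u)) ×
    (∀ g h → g ∈ G → h ∈ G → ∃ λ k → k ∈ G × (∀ u → fun k u ≡ fun g (fun h u))) ×
    (∀ g → g ∈ G → ∃ λ k → k ∈ G × (∀ u → fun k u ≡ inv g u))

  -- orb : Fin N → Fin n labels the orbits of G, i.e. it is surjective and
  -- orb u ≡ orb v iff v = g u for some g ∈ G  (so G has exactly n orbits)
  IsOrbitLabelling : List Automorphism → (n : ℕ) → (Fin N → Fin n) → Set
  IsOrbitLabelling G n orb =
    (∀ a → ∃ λ u → orb u ≡ a) ×
    (∀ u v → orb u ≡ orb v → ∃ λ g → g ∈ G × fun g u ≡ v) ×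
    (∀ u v g → g ∈ G → fun g u ≡ v → orb u ≡ orb v)

  OrbitsEqualLength : (n : ℕ) → (Fin N → Fin n) → Set
  OrbitsEqualLength n orb =
    ∀ a b → count (λ u → ⌊ orb u ≟ a ⌋) ≡ count (λ u → ⌊ orb u ≟ b ⌋)

  IsQuotientMatrix : ℕ → (n : ℕ) → (Fin N → Fin n) → (Fin n → Fin n → ℕ) → Set
  IsQuotientMatrix i n orb M =
    ∀ u b → count (λ v → ⌊ orb v ≟ b ⌋ ∧ ⌊≡⌋ (dist u v) i) ≡ M (orb u) b

module _ {c ℓ} (R : CommutativeRing c ℓ) where
  open CommutativeRing R

  ιℕ : ℕ → Carrier
  ιℕ zero    = 0#
  ιℕ (suc n) = 1# + ιℕ n

  Σᶠ : ∀ {n} → (Fin n → Carrier) → Carrier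
  Σᶠ {zero}  f = 0#
  Σᶠ {suc n} f = f Fin.zero + Σᶠ {n} (λ x → f (Fin.suc x))

  IsField : Set (c ⊔ ℓ)
  IsField = (¬ (0# ≈ 1#)) × (∀ x → ¬ (x ≈ 0#) → ∃ λ y → x * y ≈ 1#)

  HasOrder : ℕ → Set (c ⊔ ℓ)
  HasOrder q = Σ (Fin q → Carrier) λ e →
    (∀ x → ∃ λ j → e j ≈ x) × (∀ j k → e j ≈ e k → j ≡ k)

  IsFiniteField : (q p : ℕ) → Set (c ⊔ ℓ)
  IsFiniteField q p = IsField × HasOrder q × (ιℕ p ≈ 0#)

  -- the linear code over R spanned by the rows of an integer matrix M
  -- (entries mapped into R, i.e. reduced mod the characteristic) is
  -- self-orthogonal: any two codewords have standard inner product 0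
  RowSpanSelfOrthogonal : ∀ {n} → (Fin n → Fin n → ℕ) → Set (c ⊔ ℓ)
  RowSpanSelfOrthogonal {n} M =
    ∀ (x y : Fin n → Carrier) →
      let cx = λ j → Σᶠ (λ a → x a * ιℕ (M a j))
          cy = λ j → Σᶠ (λ a → y a * ιℕ (M a j))
      in Σᶠ (λ j → cx j * cy j) ≈ 0#

module Submission where

-- Let A be the distance-i matrix and M its quotient matrix for the orbit partition.
-- Double counting the A-weight between two cells gives size a * M a b = size b * M b a,
-- so M is symmetric because the orbits have equal length. Quotient matrices are
-- compatible with products, so M Mᵀ = M² is the quotient of A², whose (u , w) entry is
-- the intersection number p^{δ(u,w)}_{i,i}; hence p divides every entry of M Mᵀ. The
-- inner product of the codewords x M and y M is x (M Mᵀ) yᵀ, which therefore vanishes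
-- in characteristic p.

open import Defs
open import Level using (Level)
open import Data.Nat using (ℕ; _≤_; _^_)
open import Data.Nat.Divisibility using (_∣_)
open import Data.Nat.Primality using (Prime)
open import Data.Fin using (Fin)
open import Data.List using (List)
open import Algebra.Bundles using (CommutativeRing)

open import Data.Fin using (zero; suc)
open import Data.Nat.Divisibility using (divides)
import Data.Nat as ℕ
import Data.Nat.Properties as ℕ
import Algebra.Properties.Semiring.Sum as SemiringSum
open import Relation.Binary.PropositionalEquality as ≡ using (_≡_)

module ℕΣ = SemiringSum ℕ.+-*-semiring

module RowSpan {c ℓ} (F : CommutativeRing c ℓ) where
  open CommutativeRing F hiding (zero)
  open SemiringSum semiring
  open import Algebra.Properties.Semiring.Mult semiring using (_×_; ×-homo-+; ×1-homo-*)
  open import Algebra.Properties.CommutativeSemigroup *-commutativeSemigroup using (interchange)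
  open import Relation.Binary.Reasoning.Setoid setoid

  Σᶠ≡sum : ∀ {n} (f : Fin n → Carrier) → Σᶠ F f ≡ sum f
  Σᶠ≡sum {ℕ.zero}  f = ≡.refl
  Σᶠ≡sum {ℕ.suc n} f = ≡.cong (f zero +_) (Σᶠ≡sum (λ x → f (suc x)))

  ιℕ≡×1# : ∀ k → ιℕ F k ≡ k × 1#
  ιℕ≡×1# ℕ.zero    = ≡.refl
  ιℕ≡×1# (ℕ.suc k) = ≡.cong (1# +_) (ιℕ≡×1# k)

  ιℕ-homo-* : ∀ k l → ιℕ F (k ℕ.* l) ≈ ιℕ F k * ιℕ F l
  ιℕ-homo-* k l = begin
    ιℕ F (k ℕ.* l)           ≡⟨ ιℕ≡×1# (k ℕ.* l) ⟩
    (k ℕ.* l) × 1#           ≈⟨ ×1-homo-* k l ⟩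
    (k × 1#) * (l × 1#)      ≡⟨ ≡.cong₂ _*_ (ιℕ≡×1# k) (ιℕ≡×1# l) ⟨
    ιℕ F k * ιℕ F l          ∎

  ιℕ-homo-sum : ∀ {n} (f : Fin n → ℕ) → ιℕ F (ℕΣ.sum f) ≈ sum (λ j → ιℕ F (f j))
  ιℕ-homo-sum {ℕ.zero}  f = refl
  ιℕ-homo-sum {ℕ.suc n} f = begin
    ιℕ F (f zero ℕ.+ ℕΣ.sum (λ j → f (suc j)))       ≡⟨ ιℕ≡×1# (f zero ℕ.+ ℕΣ.sum (λ j → f (suc j))) ⟩
    (f zero ℕ.+ ℕΣ.sum (λ j → f (suc j))) × 1#       ≈⟨ ×-homo-+ 1# (f zero) _ ⟩
    f zero × 1# + ℕΣ.sum (λ j → f (suc j)) × 1#      ≡⟨ ≡.cong₂ _+_ (ιℕ≡×1# (f zero)) (ιℕ≡×1# (ℕΣ.sum (λ j → f (suc j)))) ⟨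
    ιℕ F (f zero) + ιℕ F (ℕΣ.sum (λ j → f (suc j)))  ≈⟨ +-congˡ (ιℕ-homo-sum (λ j → f (suc j))) ⟩
    ιℕ F (f zero) + sum (λ j → ιℕ F (f (suc j)))     ∎

  ∣⇒ιℕ≈0 : ∀ {p k} → ιℕ F p ≈ 0# → p ∣ k → ιℕ F k ≈ 0#
  ∣⇒ιℕ≈0 {p} ιp≈0 (divides q ≡.refl) = begin
    ιℕ F (q ℕ.* p)    ≈⟨ ιℕ-homo-* q p ⟩
    ιℕ F q * ιℕ F p   ≈⟨ *-congˡ ιp≈0 ⟩
    ιℕ F q * 0#       ≈⟨ zeroʳ _ ⟩
    0#                ∎

  rowCombination-inner : ∀ {n} (M : Fin n → Fin n → Carrier) (x y : Fin n → Carrier) →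
    sum (λ j → sum (λ a → x a * M a j) * sum (λ b → y b * M b j))
      ≈ sum (λ a → sum (λ b → (x a * y b) * sum (λ j → M a j * M b j)))
  rowCombination-inner {n} M x y = begin
    sum (λ j → sum (λ a → x a * M a j) * sum (λ b → y b * M b j))
      ≈⟨ sum-cong-≋ {n} (λ j → trans (*-distribʳ-sum {n} _ _) (sum-cong-≋ {n} (λ a → *-distribˡ-sum {n} _ _))) ⟩
    sum (λ j → sum (λ a → sum (λ b → (x a * M a j) * (y b * M b j))))
      ≈⟨ sum-cong-≋ {n} (λ j → sum-cong-≋ {n} (λ a → sum-cong-≋ {n} (λ b → interchange _ _ _ _))) ⟩
    sum (λ j → sum (λ a → sum (λ b → (x a * y b) * (M a j * M b j))))
      ≈⟨ ∑-comm {n} {n} _ ⟩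
    sum (λ a → sum (λ j → sum (λ b → (x a * y b) * (M a j * M b j))))
      ≈⟨ sum-cong-≋ {n} (λ a → ∑-comm {n} {n} _) ⟩
    sum (λ a → sum (λ b → sum (λ j → (x a * y b) * (M a j * M b j))))
      ≈⟨ sum-cong-≋ {n} (λ a → sum-cong-≋ {n} (λ b → sym (*-distribˡ-sum {n} _ _))) ⟩
    sum (λ a → sum (λ b → (x a * y b) * sum (λ j → M a j * M b j)))
      ∎

  char∣gram⇒rowSpanSelfOrthogonal : ∀ {p n} (M : Fin n → Fin n → ℕ) → ιℕ F p ≈ 0# →
    (∀ a b → p ∣ ℕΣ.sum (λ j → M a j ℕ.* M b j)) → RowSpanSelfOrthogonal F M
  char∣gram⇒rowSpanSelfOrthogonal {p} {n} M ιp≈0 p∣gram x y = begin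
    Σᶠ F (λ j → Σᶠ F (λ a → x a * ιM a j) * Σᶠ F (λ b → y b * ιM b j))
      ≡⟨ Σᶠ≡sum {n} _ ⟩
    sum (λ j → Σᶠ F (λ a → x a * ιM a j) * Σᶠ F (λ b → y b * ιM b j))
      ≡⟨ sum-cong-≗ {n} (λ j → ≡.cong₂ _*_ (Σᶠ≡sum {n} _) (Σᶠ≡sum {n} _)) ⟩
    sum (λ j → sum (λ a → x a * ιM a j) * sum (λ b → y b * ιM b j))
      ≈⟨ rowCombination-inner ιM x y ⟩
    sum (λ a → sum (λ b → (x a * y b) * sum (λ j → ιM a j * ιM b j)))
      ≈⟨ sum-cong-≋ {n} (λ a → sum-cong-≋ {n} (λ b → *-congˡ (gram≈0 a b))) ⟩
    sum (λ a → sum (λ b → (x a * y b) * 0#))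
      ≈⟨ sum-cong-≋ {n} (λ a → trans (sum-cong-≋ {n} (λ b → zeroʳ _)) (sum-replicate-zero n)) ⟩
    sum {n} (λ _ → 0#)
      ≈⟨ sum-replicate-zero n ⟩
    0# ∎
    where
    ιM : Fin n → Fin n → Carrier
    ιM a j = ιℕ F (M a j)
    gram≈0 : ∀ a b → sum (λ j → ιM a j * ιM b j) ≈ 0#
    gram≈0 a b = begin
      sum (λ j → ιM a j * ιM b j)                  ≈⟨ sum-cong-≋ {n} (λ j → sym (ιℕ-homo-* (M a j) (M b j))) ⟩
      sum (λ j → ιℕ F (M a j ℕ.* M b j))           ≈⟨ sym (ιℕ-homo-sum (λ j → M a j ℕ.* M b j)) ⟩
      ιℕ F (ℕΣ.sum (λ j → M a j ℕ.* M b j))        ≈⟨ ∣⇒ιℕ≈0 ιp≈0 (p∣gram a b) ⟩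
      0#                                           ∎

open import Data.Bool using (Bool; true; false; T; _∧_; _∨_; not; if_then_else_)
open import Data.Bool.Properties using (T-≡; T-∧; T-∨; ⇔→≡)
open import Data.Nat using (zero; suc; _+_; _*_; NonZero; >-nonZero)
open import Data.Nat.Properties using (*-assoc; *-identityˡ; +-identityʳ; *-cancelˡ-≡; m≤m+n; m≤n+m; ≤-trans)
open import Data.Nat.Divisibility using (∣m∣n⇒∣m+n; ∣n⇒∣m*n; _∣0)
open import Data.Fin using (_≟_; toℕ)
open import Data.Product using (∃; _×_; _,_)
open import Data.Sum using (_⊎_; inj₁; inj₂)
open import Function using (_∘_)
open import Function.Bundles using (Equivalence; _⇔_; mk⇔)
open import Data.Empty using (⊥-elim)
open import Relation.Nullary using (yes; no)
open import Relation.Nullary.Decidable using (⌊_⌋; toWitness; fromWitness)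
open import Relation.Binary.PropositionalEquality using (refl; sym; trans; cong; cong₂; subst; _≗_; module ≡-Reasoning)
open import Algebra.Properties.CommutativeSemigroup ℕ.*-commutativeSemigroup using (x∙yz≈y∙xz)
open ℕΣ using (sum; sum-cong-≗; ∑-comm; *-distribˡ-sum; *-distribʳ-sum; sum-replicate-zero)
open Equivalence using (to; from)

𝟙 : Bool → ℕ
𝟙 b = if b then 1 else 0

𝟙-∧ : ∀ a b → 𝟙 (a ∧ b) ≡ 𝟙 a * 𝟙 b
𝟙-∧ true  b = sym (+-identityʳ (𝟙 b))
𝟙-∧ false b = refl

count≡sum : ∀ {N} (P : Fin N → Bool) → count P ≡ sum (λ x → 𝟙 (P x))
count≡sum {zero}  P = refl
count≡sum {suc N} P = cong (𝟙 (P zero) +_) (count≡sum (λ x → P (suc x)))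

count-cong : ∀ {N} {P Q : Fin N → Bool} → P ≗ Q → count P ≡ count Q
count-cong {P = P} {Q} P≗Q = begin
  count P                ≡⟨ count≡sum P ⟩
  sum (λ x → 𝟙 (P x))    ≡⟨ sum-cong-≗ (λ x → cong 𝟙 (P≗Q x)) ⟩
  sum (λ x → 𝟙 (Q x))    ≡⟨ count≡sum Q ⟨
  count Q                ∎
  where open ≡-Reasoning

∣-sum : ∀ {d n} (f : Fin n → ℕ) → (∀ x → d ∣ f x) → d ∣ sum f
∣-sum {d} {zero}  f d∣f = d ∣0
∣-sum {d} {suc n} f d∣f = ∣m∣n⇒∣m+n (d∣f zero) (∣-sum (λ x → f (suc x)) (λ x → d∣f (suc x)))

≤-sum : ∀ {n} (f : Fin n → ℕ) x → f x ≤ sum f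
≤-sum f zero    = m≤m+n (f zero) _
≤-sum f (suc x) = ≤-trans (≤-sum (λ y → f (suc y)) x) (m≤n+m _ (f zero))

δ : ∀ {n} → Fin n → Fin n → ℕ
δ x y = 𝟙 ⌊ x ≟ y ⌋

δ-refl : ∀ {n} (x : Fin n) → δ x x ≡ 1
δ-refl x with x ≟ x
... | yes _  = refl
... | no x≢x = ⊥-elim (x≢x refl)

δ-subst : ∀ {n} (x y : Fin n) (g : Fin n → ℕ) → δ x y * g x ≡ δ x y * g y
δ-subst x y g with x ≟ y
... | yes refl = refl
... | no _     = refl

δ-suc : ∀ {n} (x y : Fin n) → δ (suc x) (suc y) ≡ δ x y
δ-suc x y with x ≟ y
... | yes _ = refl
... | no _  = refl

∑-δ : ∀ {n} (x : Fin n) (g : Fin n → ℕ) → sum (λ y → δ x y * g y) ≡ g x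
∑-δ {suc n} zero g = begin
  1 * g zero + sum (λ y → 0 * g (suc y))   ≡⟨ cong₂ _+_ (*-identityˡ (g zero)) (sum-replicate-zero n) ⟩
  g zero + 0                               ≡⟨ +-identityʳ (g zero) ⟩
  g zero                                   ∎
  where open ≡-Reasoning
∑-δ {suc n} (suc x) g = begin
  δ (suc x) zero * g zero + sum (λ y → δ (suc x) (suc y) * g (suc y))   ≡⟨ cong (0 +_) (sum-cong-≗ (λ y → cong (_* g (suc y)) (δ-suc x y))) ⟩
  sum (λ y → δ x y * g (suc y))                                          ≡⟨ ∑-δ x (λ y → g (suc y)) ⟩
  g (suc x)                                                              ∎
  where open ≡-Reasoning

_·ᴹ_ : ∀ {l m n} → (Fin l → Fin m → ℕ) → (Fin m → Fin n → ℕ) → Fin l → Fin n → ℕ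
(A ·ᴹ B) a c = sum (λ b → A a b * B b c)

IsSymmetric : ∀ {n} → (Fin n → Fin n → ℕ) → Set
IsSymmetric A = ∀ u v → A u v ≡ A v u

module Partition {N n : ℕ} (π : Fin N → Fin n) where

  size : Fin n → ℕ
  size a = sum (λ u → δ (π u) a)

  IsQuotientOf : (Fin N → Fin N → ℕ) → (Fin n → Fin n → ℕ) → Set
  IsQuotientOf A M = ∀ u b → sum (λ v → δ (π v) b * A u v) ≡ M (π u) b

  flow : (Fin N → Fin N → ℕ) → Fin n → Fin n → ℕ
  flow A a b = sum (λ u → sum (λ v → δ (π u) a * (δ (π v) b * A u v)))

  size-nonZero : ∀ u → NonZero (size (π u))
  size-nonZero u = >-nonZero (subst (_≤ size (π u)) (δ-refl (π u)) (≤-sum (λ v → δ (π v) (π u)) u))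

  flow≡size*quotient : ∀ {A M} → IsQuotientOf A M → ∀ a b → flow A a b ≡ size a * M a b
  flow≡size*quotient {A} {M} quot a b = begin
    sum (λ u → sum (λ v → δ (π u) a * (δ (π v) b * A u v)))  ≡⟨ sum-cong-≗ {N} (λ u → *-distribˡ-sum {N} (δ (π u) a) _) ⟨
    sum (λ u → δ (π u) a * sum (λ v → δ (π v) b * A u v))    ≡⟨ sum-cong-≗ {N} (λ u → cong (δ (π u) a *_) (quot u b)) ⟩
    sum (λ u → δ (π u) a * M (π u) b)                        ≡⟨ sum-cong-≗ {N} (λ u → δ-subst (π u) a (λ c → M c b)) ⟩
    sum (λ u → δ (π u) a * M a b)                            ≡⟨ *-distribʳ-sum {N} (M a b) (λ u → δ (π u) a) ⟨
    size a * M a b                                           ∎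
    where open ≡-Reasoning

  flow-sym : ∀ {A} → IsSymmetric A → ∀ a b → flow A a b ≡ flow A b a
  flow-sym {A} A-sym a b = trans (∑-comm {N} {N} _) (sum-cong-≗ {N} (λ v → sum-cong-≗ {N} (λ u →
    trans (x∙yz≈y∙xz (δ (π u) a) (δ (π v) b) (A u v)) (cong (λ z → δ (π v) b * (δ (π u) a * z)) (A-sym u v)))))

  quotient-sym : ∀ {A M} → IsSymmetric A → IsQuotientOf A M → (∀ a → ∃ λ u → π u ≡ a) →
    (∀ a b → size a ≡ size b) → IsSymmetric M
  quotient-sym {A} {M} A-sym quot surj equal a b with surj a
  ... | u , refl = *-cancelˡ-≡ (M (π u) b) (M b (π u)) (size (π u)) {{size-nonZero u}} (begin
    size (π u) * M (π u) b  ≡⟨ flow≡size*quotient {M = M} quot (π u) b ⟨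
    flow A (π u) b          ≡⟨ flow-sym A-sym (π u) b ⟩
    flow A b (π u)          ≡⟨ flow≡size*quotient {M = M} quot b (π u) ⟩
    size b * M b (π u)      ≡⟨ cong (_* M b (π u)) (equal b (π u)) ⟩
    size (π u) * M b (π u)  ∎)
    where open ≡-Reasoning

  quotient-lift : ∀ {A M} → IsQuotientOf A M → ∀ u (g : Fin n → ℕ) →
    sum (λ j → M (π u) j * g j) ≡ sum (λ v → A u v * g (π v))
  quotient-lift {A} {M} quot u g = begin
    sum (λ j → M (π u) j * g j)                              ≡⟨ sum-cong-≗ {n} (λ j → cong (_* g j) (quot u j)) ⟨
    sum (λ j → sum (λ v → δ (π v) j * A u v) * g j)          ≡⟨ sum-cong-≗ {n} (λ j → *-distribʳ-sum {N} (g j) _) ⟩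
    sum (λ j → sum (λ v → δ (π v) j * A u v * g j))          ≡⟨ ∑-comm {n} {N} _ ⟩
    sum (λ v → sum (λ j → δ (π v) j * A u v * g j))          ≡⟨ sum-cong-≗ {N} (λ v → sum-cong-≗ {n} (λ j → *-assoc (δ (π v) j) (A u v) (g j))) ⟩
    sum (λ v → sum (λ j → δ (π v) j * (A u v * g j)))        ≡⟨ sum-cong-≗ {N} (λ v → ∑-δ (π v) (λ j → A u v * g j)) ⟩
    sum (λ v → A u v * g (π v))                              ∎
    where open ≡-Reasoning

  quotient-·ᴹ : ∀ {A B M K} → IsQuotientOf A M → IsQuotientOf B K → IsQuotientOf (A ·ᴹ B) (M ·ᴹ K)
  quotient-·ᴹ {A} {B} {M} {K} quotA quotB u b = begin
    sum (λ w → δ (π w) b * sum (λ v → A u v * B v w))        ≡⟨ sum-cong-≗ {N} (λ w → *-distribˡ-sum {N} (δ (π w) b) _) ⟩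
    sum (λ w → sum (λ v → δ (π w) b * (A u v * B v w)))      ≡⟨ sum-cong-≗ {N} (λ w → sum-cong-≗ {N} (λ v → x∙yz≈y∙xz (δ (π w) b) (A u v) (B v w))) ⟩
    sum (λ w → sum (λ v → A u v * (δ (π w) b * B v w)))      ≡⟨ ∑-comm {N} {N} _ ⟩
    sum (λ v → sum (λ w → A u v * (δ (π w) b * B v w)))      ≡⟨ sum-cong-≗ {N} (λ v → *-distribˡ-sum {N} (A u v) _) ⟨
    sum (λ v → A u v * sum (λ w → δ (π w) b * B v w))        ≡⟨ sum-cong-≗ {N} (λ v → cong (A u v *_) (quotB v b)) ⟩
    sum (λ v → A u v * K (π v) b)                            ≡⟨ quotient-lift {M = M} quotA u (λ j → K j b) ⟨
    sum (λ j → M (π u) j * K j b)                            ∎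
    where open ≡-Reasoning

  quotient-gram-divisible : ∀ {A M p} → IsSymmetric A → IsQuotientOf A M → (∀ a → ∃ λ u → π u ≡ a) →
    (∀ a b → size a ≡ size b) → (∀ u w → p ∣ (A ·ᴹ A) u w) → ∀ a b → p ∣ sum (λ j → M a j * M b j)
  quotient-gram-divisible {A} {M} {p} A-sym quot surj equal p∣A² a b with surj a
  ... | u , refl = subst (p ∣_) M²≡ (∣-sum {n = N} _ (λ w → ∣n⇒∣m*n (δ (π w) b) (p∣A² u w)))
    where
    M²≡ : sum (λ w → δ (π w) b * (A ·ᴹ A) u w) ≡ sum (λ j → M (π u) j * M b j)
    M²≡ = trans (quotient-·ᴹ {M = M} {K = M} quot quot u b)
                (sum-cong-≗ {n} (λ j → cong (M (π u) j *_) (quotient-sym A-sym quot surj equal j b)))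

T-anyF : ∀ {N} {P : Fin N → Bool} → T (anyF P) ⇔ ∃ λ x → T (P x)
T-anyF {N} {P} = mk⇔ (⇒ {N} P) (⇐ {N} P)
  where
  ⇒ : ∀ {N} (P : Fin N → Bool) → T (anyF P) → ∃ λ x → T (P x)
  ⇒ {suc N} P t with to T-∨ t
  ... | inj₁ p = zero , p
  ... | inj₂ q with ⇒ (λ x → P (suc x)) q
  ... | x , p = suc x , p
  ⇐ : ∀ {N} (P : Fin N → Bool) → (∃ λ x → T (P x)) → T (anyF P)
  ⇐ P (zero  , p) = from T-∨ (inj₁ p)
  ⇐ P (suc x , p) = from T-∨ (inj₂ (⇐ (λ y → P (suc y)) (x , p)))

module _ {N : ℕ} (Γ : Graph N) where
  open Graph Γ

  T-reach-suc : ∀ k {u v} →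
    T (reach Γ (suc k) u v) ⇔ (T (reach Γ k u v) ⊎ ∃ λ w → T (adj u w) × T (reach Γ k w v))
  T-reach-suc k = mk⇔ ⇒ ⇐
    where
    ⇒ : ∀ {u v} → T (reach Γ (suc k) u v) → T (reach Γ k u v) ⊎ ∃ λ w → T (adj u w) × T (reach Γ k w v)
    ⇒ t with to T-∨ t
    ... | inj₁ r = inj₁ r
    ... | inj₂ q with to T-anyF q
    ... | w , s = inj₂ (w , to T-∧ s)
    ⇐ : ∀ {u v} → (T (reach Γ k u v) ⊎ ∃ λ w → T (adj u w) × T (reach Γ k w v)) → T (reach Γ (suc k) u v)
    ⇐ (inj₁ r)           = from T-∨ (inj₁ r)
    ⇐ (inj₂ (w , a , r)) = from T-∨ (inj₂ (from T-anyF (w , from T-∧ (a , r))))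

  reach-snoc : ∀ k {u w v} → T (reach Γ k u w) → T (adj w v) → T (reach Γ (suc k) u v)
  reach-snoc zero {u} {w} {v} r a with toWitness {a? = u ≟ w} r
  ... | refl = from (T-reach-suc zero) (inj₂ (v , a , fromWitness {a? = v ≟ v} refl))
  reach-snoc (suc k) r a with to (T-reach-suc k) r
  ... | inj₁ r′             = from (T-reach-suc (suc k)) (inj₁ (reach-snoc k r′ a))
  ... | inj₂ (w′ , a′ , r′) = from (T-reach-suc (suc k)) (inj₂ (w′ , a′ , reach-snoc k r′ a))

  reach-sym : ∀ k {u v} → T (reach Γ k u v) → T (reach Γ k v u)
  reach-sym zero {u} {v} r with toWitness {a? = u ≟ v} r
  ... | refl = r
  reach-sym (suc k) {u} r with to (T-reach-suc k) r
  ... | inj₁ r′            = from (T-reach-suc k) (inj₁ (reach-sym k r′))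
  ... | inj₂ (w , a , r′) = reach-snoc k (reach-sym k r′) (subst T (symm u w) a)

  dist-sym : ∀ u v → dist Γ u v ≡ dist Γ v u
  dist-sym u v = count-cong {N} (λ k → cong not (reach-comm (toℕ k)))
    where
    reach-comm : ∀ k → reach Γ k u v ≡ reach Γ k v u
    reach-comm k = ⇔→≡ (mk⇔ (to T-≡ ∘ reach-sym k ∘ from T-≡) (to T-≡ ∘ reach-sym k ∘ from T-≡))

  distanceMatrix : ℕ → Fin N → Fin N → ℕ
  distanceMatrix i u v = 𝟙 (⌊≡⌋ Γ (dist Γ u v) i)

  distanceMatrix-sym : ∀ i → IsSymmetric (distanceMatrix i)
  distanceMatrix-sym i u v = cong (λ k → 𝟙 (⌊≡⌋ Γ k i)) (dist-sym u v)

  distanceMatrix-square : ∀ {d pn i} → IsDistanceRegular Γ d pn → i ≤ d →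
    ∀ u w → (distanceMatrix i ·ᴹ distanceMatrix i) u w ≡ pn i i (dist Γ u w)
  distanceMatrix-square {pn = pn} {i} ((_ , diam , _) , drg) i≤d u w = begin
    sum (λ v → 𝟙 (⌊≡⌋ Γ (dist Γ u v) i) * 𝟙 (⌊≡⌋ Γ (dist Γ v w) i))  ≡⟨ sum-cong-≗ {N} (λ v → 𝟙-∧ (⌊≡⌋ Γ (dist Γ u v) i) _) ⟨
    sum (λ v → 𝟙 (⌊≡⌋ Γ (dist Γ u v) i ∧ ⌊≡⌋ Γ (dist Γ v w) i))     ≡⟨ count≡sum {N} _ ⟨
    count (λ v → ⌊≡⌋ Γ (dist Γ u v) i ∧ ⌊≡⌋ Γ (dist Γ v w) i)        ≡⟨ drg i i _ i≤d i≤d (diam u w) u w refl ⟩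
    pn i i (dist Γ u w)                                               ∎
    where open ≡-Reasoning

  module _ {n} {orb : Fin N → Fin n} where
    open Partition orb

    quotientMatrix⇒isQuotientOf : ∀ {i M} → IsQuotientMatrix Γ i n orb M → IsQuotientOf (distanceMatrix i) M
    quotientMatrix⇒isQuotientOf {i} quot u b = begin
      sum (λ v → δ (orb v) b * distanceMatrix i u v)                 ≡⟨ sum-cong-≗ {N} (λ v → 𝟙-∧ ⌊ orb v ≟ b ⌋ _) ⟨
      sum (λ v → 𝟙 (⌊ orb v ≟ b ⌋ ∧ ⌊≡⌋ Γ (dist Γ u v) i))          ≡⟨ count≡sum {N} _ ⟨
      count (λ v → ⌊ orb v ≟ b ⌋ ∧ ⌊≡⌋ Γ (dist Γ u v) i)            ≡⟨ quot u b ⟩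
      _                                                              ∎
      where open ≡-Reasoning

    orbitsEqualLength⇒equalSize : OrbitsEqualLength Γ n orb → ∀ a b → size a ≡ size b
    orbitsEqualLength⇒equalSize equal a b =
      trans (sym (count≡sum {N} (λ u → ⌊ orb u ≟ a ⌋))) (trans (equal a b) (count≡sum {N} (λ u → ⌊ orb u ≟ b ⌋)))

corollary3p4 : ∀ {N : ℕ} (Γ : Graph N) (d : ℕ) (pn : ℕ → ℕ → ℕ → ℕ) (p : ℕ) →
    IsDistanceRegular Γ d pn → Prime p →
    (G : List (Automorphism Γ)) → IsAutGroup Γ G →
    (n : ℕ) (orb : Fin N → Fin n) → IsOrbitLabelling Γ G n orb → OrbitsEqualLength Γ n orb →
    (i : ℕ) → 1 ≤ i → i ≤ d → (∀ k → k ≤ d → p ∣ pn i i k) →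
    (M : Fin n → Fin n → ℕ) → IsQuotientMatrix Γ i n orb M →
    (m : ℕ) → 1 ≤ m →
    ∀ {c ℓ : Level} (F : CommutativeRing c ℓ) → IsFiniteField F (p ^ m) p →
    RowSpanSelfOrthogonal F M
corollary3p4 Γ _ _ p drg@((_ , diam , _) , _) _ _ _ _ orb (surj , _ , _) equal i _ i≤d p∣pᵢᵢ M quot _ _ F (_ , _ , ιp≈0) =
  RowSpan.char∣gram⇒rowSpanSelfOrthogonal F M ιp≈0
    (Partition.quotient-gram-divisible orb {M = M} (distanceMatrix-sym Γ i) (quotientMatrix⇒isQuotientOf Γ {M = M} quot) surj
      (orbitsEqualLength⇒equalSize Γ equal) p∣Aᵢ²)
  where
  p∣Aᵢ² : ∀ u w → p ∣ (distanceMatrix Γ i ·ᴹ distanceMatrix Γ i) u w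
  p∣Aᵢ² u w = subst (p ∣_) (sym (distanceMatrix-square Γ drg i≤d u w)) (p∣pᵢᵢ _ (diam u w))
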